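{- Let $X=(x_1,\dots,x_{|X|})$ and $X'=(x'_1,\dots,x'_{|X'|})$ be sequences of integers each sorted in ascending order, and let $a,a'\in\mathbb Z_{\ge 0}$. Consider the procedure $\mathrm{Match}(X,X',a,a')$: set $K\leftarrow\sum_{i=1}^{|X'|}x'_i$ and $h\leftarrow 0$; for $i=1,\dots,|X|$: if no index $h'>h$ satisfies $x_i\le x'_{h'}$, return no; otherwise let $h'$ be the smallest index with $h'>h$ and $x_i\le x'_{h'}$, and set $K\leftarrow K-x'_{h'}$, $h\leftarrow h'$. After the loop, return yes if $a\le K+a'$ and no otherwise. Then $\mathrm{Match}(X,X',a,a')$ returns yes if and only if there exists an injective function $g\colon\{1,\dots,|X|\}\to\{1,\dots,|X'|\}$ such that $x_i\le x'_{g(i)}$ for all $i\in\{1,\dots,|X|\}$ and $a\le a'+\sum_{i\in\{1,\dots,|X'|\}\setminus\{g(1),\dots,g(|X|)\}}x'_i$. -}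

module Defs where

open import Data.Nat using (ℕ; zero; suc)
open import Data.Integer using (ℤ; _+_; _-_; _≤_; _≤?_; +_)
open import Data.Fin using (Fin; toℕ)
open import Data.Vec using (Vec; lookup)
open import Data.Bool using (Bool; true; false)
open import Data.Maybe using (Maybe; just; nothing)
open import Relation.Nullary using (yes; no; ¬_)
open import Data.List using (List; []; _∷_)

SortedAsc : ∀ {n} → Vec ℤ n → Set
SortedAsc {n} v = ∀ (i j : Fin n) → toℕ i Data.Nat.≤ toℕ j → lookup v i ≤ lookup v j

vsum : ∀ {n} → Vec ℤ n → ℤ
vsum Data.Vec.[] = + 0
vsum (x Data.Vec.∷ v) = x + vsum v

-- Indices are 1-based as in the paper: position k (1 ≤ k ≤ m) of X' is
-- lookup X' at Fin with toℕ = k - 1.  'h' is a 1-based index (0 = initial).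
-- findFrom x X' k fuel : smallest 1-based index h' with h' ≥ k, h' ≤ m and x ≤ x'_{h'}.
findFrom : ∀ {m} → ℤ → Vec ℤ m → ℕ → Maybe ℕ
findFrom {m} x X' k = go k (m Data.Nat.∸ (k Data.Nat.∸ 1))
  where
  at : ℕ → Maybe ℤ
  at zero = nothing
  at (suc j) with Data.Nat._<?_ j m
  ... | yes j<m = just (lookup X' (Data.Fin.fromℕ< j<m))
  ... | no _ = nothing
  go : ℕ → ℕ → Maybe ℕ
  go k zero = nothing
  go k (suc fuel) with at k
  ... | nothing = go (suc k) fuel
  ... | just y with x ≤? y
  ...   | yes _ = just k
  ...   | no _ = go (suc k) fuel

valueAt : ∀ {m} → Vec ℤ m → ℕ → ℤ
valueAt {m} X' zero = + 0
valueAt {m} X' (suc j) with Data.Nat._<?_ j m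
... | yes j<m = lookup X' (Data.Fin.fromℕ< j<m)
... | no _ = + 0

matchLoop : ∀ {n m} → Vec ℤ n → Vec ℤ m → ℤ → ℕ → Maybe ℤ
matchLoop Data.Vec.[] X' K h = just K
matchLoop (x Data.Vec.∷ X) X' K h with findFrom x X' (suc h)
... | nothing = nothing
... | just h' = matchLoop X X' (K - valueAt X' h') h'

Match : ∀ {n m} → Vec ℤ n → Vec ℤ m → ℕ → ℕ → Bool
Match X X' a a' with matchLoop X X' (vsum X') 0
... | nothing = false
... | just K with (+ a) ≤? (K + (+ a'))
...   | yes _ = true
...   | no _ = false

sumOutside : ∀ {n m} → (Fin n → Fin m) → Vec ℤ m → ℤ
sumOutside {n} {m} g X' = go (Data.Vec.allFin m)
  where
  open import Data.Vec using (allFin)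
  inImage : Fin m → Bool
  inImage j = Data.Vec.foldr _ (λ b acc → Data.Bool._∨_ b acc) false
                (Data.Vec.map (λ i → Relation.Nullary.Decidable.⌊ Data.Fin._≟_ (g i) j ⌋) (allFin n))
    where import Relation.Nullary.Decidable
  go : ∀ {k} → Vec (Fin m) k → ℤ
  go Data.Vec.[] = + 0
  go (j Data.Vec.∷ js) with inImage j
  ... | true = go js
  ... | false = lookup X' j + go js

-- The loop is a greedy matching: it assigns each x_i to the leftmost unused x'_h with
-- x_i ≤ x'_h and subtracts that entry from K, so an accepting run is an injective
-- dominating assignment whose unused weight is the final K.  Conversely, greedy is
-- optimal by an exchange argument: if greedy matches x₁ to f and a dominating injective g
-- matches it to d, then f ≤ g(i) for all i because X is sorted, so x'_f ≤ x'_d because X'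
-- is sorted; swapping f and d in the rest of g assigns x₂, … to positions beyond f using
-- at most as much weight.  By induction greedy succeeds and leaves at least the weight g
-- leaves, which for injective g is ΣX' minus the weight of its image.
module Submission where

open import Defs
import Data.Integer.Properties as ℤ
open import Algebra.Properties.AbelianGroup ℤ.+-0-abelianGroup using (x≈z//y; ⁻¹-∙-comm)
open import Algebra.Properties.CommutativeMonoid.Sum ℤ.+-0-commutativeMonoid
  using (sum; sum-cong-≗; ∑-distrib-+; sum-remove; sum-replicate-zero)
open import Algebra.Properties.CommutativeSemigroup ℤ.+-commutativeSemigroup using (x∙yz≈y∙xz)
open import Data.Bool using (Bool; true; false; if_then_else_; _∨_)
open import Data.Fin using (Fin; zero; suc; toℕ; _≟_; punchIn; fromℕ<)
open import Data.Fin.Permutation.Components using (transpose; transpose-inverse)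
open import Data.Fin.Properties
  using (suc-injective; 0≢1+n; punchInᵢ≢i; toℕ<n; toℕ-fromℕ<; fromℕ<-toℕ; toℕ-injective)
open import Data.Integer using (ℤ; 0ℤ; +_; -_; _+_; _-_; _≤_; _≤?_)
open import Data.Maybe using (Maybe; just; nothing)
open import Data.Nat as ℕ using (ℕ; zero; suc; z≤n; s≤s)
open import Data.Nat.Induction using (<-wellFounded)
open import Data.Nat.Properties
  using (m>n⇒m∸n≢0; m≤n⇒m∸n≡0; ≮⇒≥; pred[m∸n]≡m∸[1+n]; <⇒≤; <-irrefl; ≤∧≢⇒<; ≤-<-trans; ≤-trans;
         ≤-reflexive; ∸-monoʳ-<; n<1+n)
open import Data.Product using (Σ; _×_; _,_)
open import Data.Sum using (_⊎_; inj₁; inj₂)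
open import Data.Vec using (Vec; []; _∷_; lookup; tabulate; allFin; map; foldr)
import Data.Vec.Functional as Vector
open import Data.Vec.Properties using (tabulate-∘)
open import Function using (_∘_; id)
open import Function.Bundles using (_⇔_; mk⇔; Equivalence)
open import Function.Definitions using (Injective)
open import Induction.WellFounded using (Acc; acc)
open import Relation.Binary.PropositionalEquality
  using (_≡_; _≢_; _≗_; refl; sym; trans; cong; cong₂; subst; module ≡-Reasoning)
open import Relation.Nullary using (¬_; contradiction)
open import Relation.Nullary.Decidable using (⌊_⌋; does; yes; no; dec-true; dec-false)

i-j-k≡i-[j+k] : ∀ i j k → i - j - k ≡ i - (j + k)
i-j-k≡i-[j+k] i j k = trans (ℤ.+-assoc i (- j) (- k)) (cong (λ s → i + s) (⁻¹-∙-comm j k))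

vsum≡sum : ∀ {m} (v : Vec ℤ m) → vsum v ≡ sum (lookup v)
vsum≡sum []      = refl
vsum≡sum (x ∷ v) = cong (λ s → x + s) (vsum≡sum v)

indicator : ∀ {m} → Fin m → (Fin m → ℤ) → Fin m → ℤ
indicator j₀ w j = if does (j₀ ≟ j) then w j else 0ℤ

sum-indicator : ∀ {m} (w : Fin m → ℤ) j₀ → sum (indicator j₀ w) ≡ w j₀
sum-indicator {suc m} w j₀ = begin
  sum (indicator j₀ w)                                   ≡⟨ sum-remove (indicator j₀ w) ⟩
  indicator j₀ w j₀ + sum (indicator j₀ w ∘ punchIn j₀)  ≡⟨ cong₂ _+_ at-j₀ (sum-cong-≗ elsewhere) ⟩
  w j₀ + sum {m} (λ _ → 0ℤ)                              ≡⟨ cong (λ s → w j₀ + s) (sum-replicate-zero m) ⟩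
  w j₀ + 0ℤ                                              ≡⟨ ℤ.+-identityʳ (w j₀) ⟩
  w j₀                                                   ∎
  where
  open ≡-Reasoning
  at-j₀ : indicator j₀ w j₀ ≡ w j₀
  at-j₀ = cong (if_then w j₀ else 0ℤ) (dec-true (j₀ ≟ j₀) refl)
  elsewhere : indicator j₀ w ∘ punchIn j₀ ≗ λ _ → 0ℤ
  elsewhere k = cong (if_then w (punchIn j₀ k) else 0ℤ)
    (dec-false (j₀ ≟ punchIn j₀ k) (punchInᵢ≢i j₀ k ∘ sym))

-- Verbatim the test local to `sumOutside`, so the two agree by definition.
inImage : ∀ {n m} → (Fin n → Fin m) → Fin m → Bool
inImage {n} g j = foldr _ (λ b acc → b ∨ acc) false (map (λ i → ⌊ g i ≟ j ⌋) (allFin n))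

inImage-suc : ∀ {n m} (g : Fin (suc n) → Fin m) j →
  inImage g j ≡ ⌊ g zero ≟ j ⌋ ∨ inImage (g ∘ suc) j
inImage-suc g j = cong (λ bs → ⌊ g zero ≟ j ⌋ ∨ foldr _ (λ b acc → b ∨ acc) false bs)
  (trans (sym (tabulate-∘ q suc)) (tabulate-∘ (q ∘ suc) id))
  where
  q : Fin _ → Bool
  q i = ⌊ g i ≟ j ⌋

inImage-missing : ∀ {n m} (g : Fin n → Fin m) j → (∀ i → g i ≢ j) → inImage g j ≡ false
inImage-missing {zero}  g j _ = refl
inImage-missing {suc n} g j g≢j rewrite inImage-suc g j with g zero ≟ j
... | yes g₀≡j = contradiction g₀≡j (g≢j zero)
... | no  _    = inImage-missing (g ∘ suc) j (g≢j ∘ suc)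

outside : ∀ {n m} → (Fin n → Fin m) → (Fin m → ℤ) → Fin m → ℤ
outside g w j = if inImage g j then 0ℤ else w j

-- `sumOutside` folds a helper `go`, local to its where-block, over `allFin m`.
-- Checking `outsideFold-solution` solves the metavariable `outsideFold` to that
-- helper, so afterwards `sumOutside g X' = outsideFold g X' (allFin m)` by definition.
mutual
  outsideFold : ∀ {n m} → (Fin n → Fin m) → Vec ℤ m → ∀ {k} → Vec (Fin m) k → ℤ
  outsideFold = _

  outsideFold-solution : ∀ {n m} (g : Fin n → Fin (suc m)) (X' : Vec ℤ (suc m)) →
    sumOutside g X' ≡ (if inImage g zero then outsideFold g X' (tabulate suc)
                       else lookup X' zero + outsideFold g X' (tabulate suc))
  outsideFold-solution {m = m} g X' with inImage g zero
  ... | true with suc m | g | X' | tabulate {n = m} (λ (j : Fin m) → suc j)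
  ...   | _ | _ | _ | _ = refl
  outsideFold-solution g X' | false = refl

outsideFold-∷ : ∀ {n m} (g : Fin n → Fin m) (X' : Vec ℤ m) {k} j (js : Vec (Fin m) k) →
  outsideFold g X' (j ∷ js) ≡ outside g (lookup X') j + outsideFold g X' js
outsideFold-∷ g X' j js with inImage g j
... | true  = sym (ℤ.+-identityˡ _)
... | false = refl

outsideFold-tabulate : ∀ {n m} (g : Fin n → Fin m) (X' : Vec ℤ m) {k} (h : Fin k → Fin m) →
  outsideFold g X' (tabulate h) ≡ sum (outside g (lookup X') ∘ h)
outsideFold-tabulate g X' {zero}  h = refl
outsideFold-tabulate g X' {suc k} h = trans (outsideFold-∷ g X' (h zero) (tabulate (h ∘ suc)))
  (cong (λ s → outside g (lookup X') (h zero) + s) (outsideFold-tabulate g X' (h ∘ suc)))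

sumOutside≡sum-outside : ∀ {n m} (g : Fin n → Fin m) (X' : Vec ℤ m) →
  sumOutside g X' ≡ sum (outside g (lookup X'))
sumOutside≡sum-outside g X' = outsideFold-tabulate g X' id

outside-∘suc : ∀ {n m} (w : Fin m → ℤ) (g : Fin (suc n) → Fin m) → Injective _≡_ _≡_ g →
  ∀ j → outside g w j + indicator (g zero) w j ≡ outside (g ∘ suc) w j
outside-∘suc w g inj j rewrite inImage-suc g j with g zero ≟ j
... | yes refl =
  trans (ℤ.+-identityˡ (w (g zero))) (cong (if_then 0ℤ else w (g zero)) (sym g₀-not-in-rest))
  where
  g₀-not-in-rest : inImage (g ∘ suc) (g zero) ≡ false
  g₀-not-in-rest = inImage-missing (g ∘ suc) (g zero) λ i e → 0≢1+n (inj (sym e))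
... | no  _    = ℤ.+-identityʳ _

sum-outside : ∀ {n m} (w : Fin m → ℤ) (g : Fin n → Fin m) → Injective _≡_ _≡_ g →
  sum (outside g w) ≡ sum w - sum (w ∘ g)
sum-outside {zero}  w g _   = sym (ℤ.+-identityʳ (sum w))
sum-outside {suc n} w g inj = begin
  sum (outside g w)                 ≡⟨ x≈z//y _ _ _ remove-g₀ ⟩
  sum (outside (g ∘ suc) w) - w₀    ≡⟨ cong (_- w₀) (sum-outside w (g ∘ suc) (suc-injective ∘ inj)) ⟩
  sum w - sum (w ∘ g ∘ suc) - w₀    ≡⟨ i-j-k≡i-[j+k] (sum w) (sum (w ∘ g ∘ suc)) w₀ ⟩
  sum w - (sum (w ∘ g ∘ suc) + w₀)  ≡⟨ cong (λ s → sum w - s) (ℤ.+-comm (sum (w ∘ g ∘ suc)) w₀) ⟩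
  sum w - sum (w ∘ g)               ∎
  where
  open ≡-Reasoning
  w₀ : ℤ
  w₀ = w (g zero)
  remove-g₀ : sum (outside g w) + w₀ ≡ sum (outside (g ∘ suc) w)
  remove-g₀ = begin
    sum (outside g w) + w₀
      ≡⟨ cong (λ s → sum (outside g w) + s) (sum-indicator w (g zero)) ⟨
    sum (outside g w) + sum (indicator (g zero) w)
      ≡⟨ ∑-distrib-+ (outside g w) (indicator (g zero) w) ⟨
    sum (λ j → outside g w j + indicator (g zero) w j)
      ≡⟨ sum-cong-≗ (outside-∘suc w g inj) ⟩
    sum (outside (g ∘ suc) w)
      ∎

sumOutside≡vsum-cost : ∀ {n m} (g : Fin n → Fin m) (X' : Vec ℤ m) → Injective _≡_ _≡_ g →
  sumOutside g X' ≡ vsum X' - sum (lookup X' ∘ g)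
sumOutside≡vsum-cost g X' inj = begin
  sumOutside g X'                         ≡⟨ sumOutside≡sum-outside g X' ⟩
  sum (outside g (lookup X'))             ≡⟨ sum-outside (lookup X') g inj ⟩
  sum (lookup X') - sum (lookup X' ∘ g)   ≡⟨ cong (λ s → s - sum (lookup X' ∘ g)) (sym (vsum≡sum X')) ⟩
  vsum X' - sum (lookup X' ∘ g)           ∎
  where open ≡-Reasoning

SortedAsc-tail : ∀ {n x} {X : Vec ℤ n} → SortedAsc (x ∷ X) → SortedAsc X
SortedAsc-tail sorted i j i≤j = sorted (suc i) (suc j) (s≤s i≤j)

injective-∷ : ∀ {n m} {f : Fin m} {g : Fin n → Fin m} → Injective _≡_ _≡_ g → (∀ i → g i ≢ f) →
  Injective _≡_ _≡_ (f Vector.∷ g)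
injective-∷ inj g≢f {zero}  {zero}  _ = refl
injective-∷ inj g≢f {zero}  {suc b} e = contradiction (sym e) (g≢f b)
injective-∷ inj g≢f {suc a} {zero}  e = contradiction e (g≢f a)
injective-∷ inj g≢f {suc a} {suc b} e = cong suc (inj e)

transpose-injective : ∀ {m} (i j : Fin m) → Injective _≡_ _≡_ (transpose i j)
transpose-injective i j {a} {b} e = begin
  a                               ≡⟨ transpose-inverse j i ⟨
  transpose j i (transpose i j a) ≡⟨ cong (transpose j i) e ⟩
  transpose j i (transpose i j b) ≡⟨ transpose-inverse j i ⟩
  b                               ∎
  where open ≡-Reasoning

transpose-away : ∀ {m} (i : Fin m) {j k} → k ≢ j →
  (k ≡ i × transpose i j k ≡ j) ⊎ (k ≢ i × transpose i j k ≡ k)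
transpose-away i {j} {k} k≢j with k ≟ i
... | yes k≡i = inj₁ (k≡i , refl)
... | no  k≢i with k ≟ j
...   | yes k≡j = contradiction k≡j k≢j
...   | no  _   = inj₂ (k≢i , refl)

sum-transpose-≤ : ∀ {m} (w : Fin m → ℤ) {i j} → w i ≤ w j →
  ∀ {n} (G : Fin n → Fin m) → Injective _≡_ _≡_ G → (∀ k → G k ≢ j) →
  w i + sum (w ∘ transpose i j ∘ G) ≤ w j + sum (w ∘ G)
sum-transpose-≤ w wi≤wj {zero} G _ _ = ℤ.+-monoˡ-≤ 0ℤ wi≤wj
sum-transpose-≤ {m} w {i} {j} wi≤wj {suc n} G inj G≢j = by-cases (transpose-away i (G≢j zero))
  where
  τ : Fin m → Fin m
  τ = transpose i j
  S S' : ℤ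
  S  = sum (w ∘ G ∘ suc)
  S' = sum (w ∘ τ ∘ G ∘ suc)
  by-cases : (G zero ≡ i × τ (G zero) ≡ j) ⊎ (G zero ≢ i × τ (G zero) ≡ G zero) →
    w i + (w (τ (G zero)) + S') ≤ w j + (w (G zero) + S)
  by-cases (inj₁ (G₀≡i , τG₀≡j)) = ℤ.≤-reflexive (begin
    w i + (w (τ (G zero)) + S')  ≡⟨ cong₂ (λ k s → w i + (w k + s)) τG₀≡j (sum-cong-≗ rest-fixed) ⟩
    w i + (w j + S)              ≡⟨ x∙yz≈y∙xz (w i) (w j) S ⟩
    w j + (w i + S)              ≡⟨ cong (λ k → w j + (w k + S)) G₀≡i ⟨
    w j + (w (G zero) + S)       ∎)
    where
    open ≡-Reasoning
    rest-fixed : w ∘ τ ∘ G ∘ suc ≗ w ∘ G ∘ suc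
    rest-fixed k with transpose-away i (G≢j (suc k))
    ... | inj₁ (Gk≡i , _)   = contradiction (inj (trans G₀≡i (sym Gk≡i))) 0≢1+n
    ... | inj₂ (_ , τGk≡Gk) = cong w τGk≡Gk
  by-cases (inj₂ (_ , τG₀≡G₀)) = begin
    w i + (w (τ (G zero)) + S')  ≡⟨ cong (λ k → w i + (w k + S')) τG₀≡G₀ ⟩
    w i + (w (G zero) + S')      ≡⟨ x∙yz≈y∙xz (w i) (w (G zero)) S' ⟩
    w (G zero) + (w i + S')      ≤⟨ ℤ.+-monoʳ-≤ (w (G zero)) rest ⟩
    w (G zero) + (w j + S)       ≡⟨ x∙yz≈y∙xz (w (G zero)) (w j) S ⟩
    w j + (w (G zero) + S)       ∎
    where
    open ℤ.≤-Reasoning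
    rest : w i + S' ≤ w j + S
    rest = sum-transpose-≤ w wi≤wj (G ∘ suc) (suc-injective ∘ inj) (G≢j ∘ suc)

module _ {m} (X' : Vec ℤ m) where

  findFromStep : ℤ → ℕ → Maybe ℕ → Maybe ℕ
  findFromStep x h next with h ℕ.<? m
  ... | no _ = nothing
  ... | yes h<m with x ≤? lookup X' (fromℕ< h<m)
  ...   | yes _ = just (suc h)
  ...   | no  _ = next

  findFrom-unfold : ∀ x h → findFrom x X' (suc h) ≡ findFromStep x h (findFrom x X' (suc (suc h)))
  findFrom-unfold x h with m ℕ.∸ h in m∸h≡
  ... | zero with h ℕ.<? m
  ...   | no  _   = refl
  ...   | yes h<m = contradiction m∸h≡ (m>n⇒m∸n≢0 h<m)
  findFrom-unfold x h | suc fuel with h ℕ.<? m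
  ...   | no h≮m  = contradiction (trans (sym m∸h≡) (m≤n⇒m∸n≡0 (≮⇒≥ h≮m))) λ ()
  ...   | yes h<m with x ≤? lookup X' (fromℕ< h<m)
  ...     | yes _ = refl
  ...     | no  _ rewrite trans (sym (pred[m∸n]≡m∸[1+n] m h)) (cong ℕ.pred m∸h≡) = refl

  record FirstFit (x : ℤ) (h : ℕ) (f : Fin m) : Set where
    field
      above : h ℕ.≤ toℕ f
      fits  : x ≤ lookup X' f
      least : ∀ j → h ℕ.≤ toℕ j → x ≤ lookup X' j → toℕ f ℕ.≤ toℕ j

  -- Positions are 0-based here: `findFrom x X' (suc h)` searches the positions ≥ h
  -- and reports position f as `suc (toℕ f)`.
  data Search (x : ℤ) (h : ℕ) : Maybe ℕ → Set where
    found : ∀ f → FirstFit x h f → Search x h (just (suc (toℕ f)))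
    none  : (∀ j → h ℕ.≤ toℕ j → ¬ x ≤ lookup X' j) → Search x h nothing

  search-skip : ∀ {x h r} (h<m : h ℕ.< m) → ¬ x ≤ lookup X' (fromℕ< h<m) →
    Search x (suc h) r → Search x h r
  search-skip {x} {h} h<m misses = λ where
      (found f ff) → found f record
        { above = <⇒≤ (FirstFit.above ff)
        ; fits  = FirstFit.fits ff
        ; least = λ j h≤j x≤j → FirstFit.least ff j (beyond j h≤j x≤j) x≤j
        }
      (none nofit) → none λ j h≤j x≤j → nofit j (beyond j h≤j x≤j) x≤j
    where
    beyond : ∀ j → h ℕ.≤ toℕ j → x ≤ lookup X' j → h ℕ.< toℕ j
    beyond j h≤j x≤j with toℕ j ℕ.≟ h
    ... | yes refl = contradiction (subst (λ k → x ≤ lookup X' k) (sym (fromℕ<-toℕ j h<m)) x≤j) misses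
    ... | no  j≢h  = ≤∧≢⇒< h≤j (j≢h ∘ sym)

  findFrom-search : ∀ x h → Search x h (findFrom x X' (suc h))
  findFrom-search x h = search h (<-wellFounded (m ℕ.∸ h))
    where
    search : ∀ h → Acc ℕ._<_ (m ℕ.∸ h) → Search x h (findFrom x X' (suc h))
    search h (acc rec) rewrite findFrom-unfold x h with h ℕ.<? m
    ... | no h≮m = none λ j h≤j _ → h≮m (≤-<-trans h≤j (toℕ<n j))
    ... | yes h<m with x ≤? lookup X' (fromℕ< h<m)
    ...   | yes fits = subst (Search x h ∘ just ∘ suc) (toℕ-fromℕ< h<m) (found (fromℕ< h<m) record
              { above = ≤-reflexive (sym (toℕ-fromℕ< h<m))
              ; fits  = fits
              ; least = λ j h≤j _ → ≤-trans (≤-reflexive (toℕ-fromℕ< h<m)) h≤j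
              })
    ...   | no misses = search-skip h<m misses (search (suc h) (rec (∸-monoʳ-< (n<1+n h) h<m)))

  valueAt-suc-toℕ : ∀ f → valueAt X' (suc (toℕ f)) ≡ lookup X' f
  valueAt-suc-toℕ f with toℕ f ℕ.<? m
  ... | yes f<m = cong (lookup X') (fromℕ<-toℕ f f<m)
  ... | no  f≮m = contradiction (toℕ<n f) f≮m

  record Matching {n} (h : ℕ) (X : Vec ℤ n) (g : Fin n → Fin m) : Set where
    constructor matching
    field
      injective : Injective _≡_ _≡_ g
      above     : ∀ i → h ℕ.≤ toℕ (g i)
      dominated : ∀ i → lookup X i ≤ lookup X' (g i)

  cost : ∀ {n} → (Fin n → Fin m) → ℤ
  cost g = sum (lookup X' ∘ g)

  matchLoop-sound : ∀ {n} (X : Vec ℤ n) K h {K'} → matchLoop X X' K h ≡ just K' →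
    Σ (Fin n → Fin m) λ g → Matching h X g × K' ≡ K - cost g
  matchLoop-sound [] K h refl = (λ ()) , matching (λ { {()} }) (λ ()) (λ ()) , sym (ℤ.+-identityʳ K)
  matchLoop-sound (x ∷ X) K h {K'} loop with findFrom x X' (suc h) | findFrom-search x h
  ... | _ | none _ with () ← loop
  ... | _ | found f ff
    with g , matching inj above dominated , K'≡ ← matchLoop-sound X _ (suc (toℕ f)) loop
    = f Vector.∷ g , matching (injective-∷ inj g≢f) above' dominated' , cost-eq
    where
    g≢f : ∀ i → g i ≢ f
    g≢f i gi≡f = <-irrefl (cong toℕ (sym gi≡f)) (above i)
    above' : ∀ i → h ℕ.≤ toℕ ((f Vector.∷ g) i)
    above' zero    = FirstFit.above ff
    above' (suc i) = ≤-trans (FirstFit.above ff) (<⇒≤ (above i))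
    dominated' : ∀ i → lookup (x ∷ X) i ≤ lookup X' ((f Vector.∷ g) i)
    dominated' zero    = FirstFit.fits ff
    dominated' (suc i) = dominated i
    cost-eq : K' ≡ K - cost (f Vector.∷ g)
    cost-eq = begin
      K'                                       ≡⟨ K'≡ ⟩
      K - valueAt X' (suc (toℕ f)) - cost g    ≡⟨ cong (λ v → K - v - cost g) (valueAt-suc-toℕ f) ⟩
      K - lookup X' f - cost g                 ≡⟨ i-j-k≡i-[j+k] K (lookup X' f) (cost g) ⟩
      K - cost (f Vector.∷ g)                  ∎
      where open ≡-Reasoning

  exchange : ∀ {n x h f} {X : Vec ℤ n} {g : Fin (suc n) → Fin m} →
    SortedAsc (x ∷ X) → SortedAsc X' → Matching h (x ∷ X) g → FirstFit x h f →
    let g' = transpose f (g zero) ∘ g ∘ suc in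
    Matching (suc (toℕ f)) X g' × lookup X' f + cost g' ≤ cost g
  exchange {f = f} {X} {g} sorted sorted' (matching inj above dominated) ff =
    matching (λ e → suc-injective (inj (transpose-injective f d e))) above' dominated' ,
    sum-transpose-≤ (lookup X') wf≤wd (g ∘ suc) (suc-injective ∘ inj) rest≢d
    where
    d : Fin m
    d = g zero
    f≤g : ∀ k → toℕ f ℕ.≤ toℕ (g k)
    f≤g k = FirstFit.least ff (g k) (above k) (ℤ.≤-trans (sorted zero k z≤n) (dominated k))
    wf≤wd : lookup X' f ≤ lookup X' d
    wf≤wd = sorted' f d (f≤g zero)
    rest≢d : ∀ i → g (suc i) ≢ d
    rest≢d i e = 0≢1+n (sym (inj e))
    above' : ∀ i → toℕ f ℕ.< toℕ (transpose f d (g (suc i)))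
    above' i with transpose-away f (rest≢d i)
    ... | inj₁ (gi≡f , τ≡d) rewrite τ≡d =
          ≤∧≢⇒< (f≤g zero) (λ f≡d → rest≢d i (trans gi≡f (toℕ-injective f≡d)))
    ... | inj₂ (gi≢f , τ≡gi) rewrite τ≡gi =
          ≤∧≢⇒< (f≤g (suc i)) (λ f≡gi → gi≢f (sym (toℕ-injective f≡gi)))
    dominated' : ∀ i → lookup X i ≤ lookup X' (transpose f d (g (suc i)))
    dominated' i with transpose-away f (rest≢d i)
    ... | inj₁ (gi≡f , τ≡d) rewrite τ≡d =
          ℤ.≤-trans (subst (λ k → lookup X i ≤ lookup X' k) gi≡f (dominated (suc i))) wf≤wd
    ... | inj₂ (_ , τ≡gi) rewrite τ≡gi = dominated (suc i)

  matchLoop-complete : ∀ {n} (X : Vec ℤ n) → SortedAsc X → SortedAsc X' →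
    ∀ K h {g} → Matching h X g → Σ ℤ λ K' → matchLoop X X' K h ≡ just K' × K - cost g ≤ K'
  matchLoop-complete [] _ _ K h _ = K , refl , ℤ.≤-reflexive (ℤ.+-identityʳ K)
  matchLoop-complete {suc n} (x ∷ X) sorted sorted' K h {g} μ@(matching _ above dominated)
    with findFrom x X' (suc h) | findFrom-search x h
  ... | _ | none nofit = contradiction (dominated zero) (nofit (g zero) (above zero))
  ... | _ | found f ff
    with μ' , f+cost≤cost ← exchange sorted sorted' μ ff
    with K' , loop , bound ← matchLoop-complete X (SortedAsc-tail sorted) sorted' _ (suc (toℕ f)) μ'
    = K' , loop , (begin
      K - cost g                              ≤⟨ ℤ.+-monoʳ-≤ K (ℤ.neg-mono-≤ f+cost≤cost) ⟩
      K - (lookup X' f + cost g')             ≡⟨ i-j-k≡i-[j+k] K (lookup X' f) (cost g') ⟨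
      K - lookup X' f - cost g'               ≡⟨ cong (λ v → K - v - cost g') (valueAt-suc-toℕ f) ⟨
      K - valueAt X' (suc (toℕ f)) - cost g'  ≤⟨ bound ⟩
      K'                                      ∎)
    where
    open ℤ.≤-Reasoning
    g' : Fin n → Fin m
    g' = transpose f (g zero) ∘ g ∘ suc

AcceptingRun : ∀ {n m} → Vec ℤ n → Vec ℤ m → ℕ → ℕ → Set
AcceptingRun X X' a a' = Σ ℤ λ K → matchLoop X X' (vsum X') 0 ≡ just K × + a ≤ K + + a'

FeasibleMatching : ∀ {n m} → Vec ℤ n → Vec ℤ m → ℕ → ℕ → Set
FeasibleMatching {n} {m} X X' a a' = Σ (Fin n → Fin m) λ g → Injective _≡_ _≡_ g ×
  (∀ i → lookup X i ≤ lookup X' (g i)) × + a ≤ + a' + sumOutside g X'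

Match≡true⇔accepting-run : ∀ {n m} (X : Vec ℤ n) (X' : Vec ℤ m) a a' →
  Match X X' a a' ≡ true ⇔ AcceptingRun X X' a a'
Match≡true⇔accepting-run X X' a a' = mk⇔ to from
  where
  to : Match X X' a a' ≡ true → AcceptingRun X X' a a'
  to accepted with matchLoop X X' (vsum X') 0
  ... | nothing with () ← accepted
  ... | just K with + a ≤? K + + a'
  ...   | yes a≤K+a' = K , refl , a≤K+a'
  ...   | no  _      with () ← accepted
  from : AcceptingRun X X' a a' → Match X X' a a' ≡ true
  from (K , loop , a≤K+a') rewrite loop with + a ≤? K + + a'
  ... | yes _      = refl
  ... | no  a≰K+a' = contradiction a≤K+a' a≰K+a'

accepting-run⇒feasible : ∀ {n m} (X : Vec ℤ n) (X' : Vec ℤ m) a a' →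
  AcceptingRun X X' a a' → FeasibleMatching X X' a a'
accepting-run⇒feasible X X' a a' (K , loop , a≤K+a')
  with g , matching inj _ dominated , K≡ ← matchLoop-sound X' X (vsum X') 0 loop
  = g , inj , dominated , (begin
    + a                    ≤⟨ a≤K+a' ⟩
    K + + a'               ≡⟨ ℤ.+-comm K (+ a') ⟩
    + a' + K               ≡⟨ cong (λ s → + a' + s) K≡outside ⟩
    + a' + sumOutside g X' ∎)
  where
  open ℤ.≤-Reasoning
  K≡outside : K ≡ sumOutside g X'
  K≡outside = trans K≡ (sym (sumOutside≡vsum-cost g X' inj))

feasible⇒accepting-run : ∀ {n m} (X : Vec ℤ n) (X' : Vec ℤ m) a a' → SortedAsc X → SortedAsc X' →
  FeasibleMatching X X' a a' → AcceptingRun X X' a a'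
feasible⇒accepting-run X X' a a' sorted sorted' (g , inj , dominated , a≤a'+outside)
  with K , loop , outside≤K ←
         matchLoop-complete X' X sorted sorted' (vsum X') 0 (matching inj (λ _ → z≤n) dominated)
  = K , loop , (begin
    + a                          ≤⟨ a≤a'+outside ⟩
    + a' + sumOutside g X'       ≡⟨ cong (λ s → + a' + s) (sumOutside≡vsum-cost g X' inj) ⟩
    + a' + (vsum X' - cost X' g) ≤⟨ ℤ.+-monoʳ-≤ (+ a') outside≤K ⟩
    + a' + K                     ≡⟨ ℤ.+-comm (+ a') K ⟩
    K + + a'                     ∎)
  where open ℤ.≤-Reasoning

mainTheorem9 : ∀ {n m} (X : Vec ℤ n) (X' : Vec ℤ m) (a a' : ℕ) →
    SortedAsc X → SortedAsc X' →
    (Match X X' a a' ≡ true) ⇔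
    (Σ (Fin n → Fin m) λ g → Injective _≡_ _≡_ g ×
       ((i : Fin n) → lookup X i ≤ lookup X' (g i)) ×
       ((+ a) ≤ (+ a') + sumOutside g X'))
mainTheorem9 X X' a a' sorted sorted' = mk⇔
  (accepting-run⇒feasible X X' a a' ∘ to (Match≡true⇔accepting-run X X' a a'))
  (from (Match≡true⇔accepting-run X X' a a') ∘ feasible⇒accepting-run X X' a a' sorted sorted')
  where open Equivalence
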